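{- Let $\{G_i\}$ be a family of graphs with a common induced subgraph $J$ with embeddings $J_i$, and let $H=\amalg\{(G_i|J_i)\}$. If the diameter of $J$ is at most $2$, then every $G_i$ is isometrically embedded in $H$.
   Context: All graphs are finite, simple and non-null. $J$ is a common induced subgraph of the $G_i$ via injective maps $\iota_i:V(J)\to V(G_i)$ with $\iota_i(u)\iota_i(v)\in E(G_i)$ iff $uv\in E(J)$; $J_i$ is the induced subgraph of $G_i$ on $\iota_i(V(J))$. $H=\amalg\{(G_i|J_i)\}$ is obtained from the disjoint union of the $G_i$ by identifying, for each $v\in V(J)$, all vertices $\iota_i(v)$ into one vertex (adjacencies of each $G_i$ are preserved), and each $G_i$ is regarded as a subgraph of $H$. A subgraph $G'$ of $H$ is isometrically embedded in $H$ if $d_{G'}(u,v)=d_H(u,v)$ for all $u,v\in V(G')$. -}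

module Defs where

open import Data.Nat using (ℕ; zero; suc; _<_; _≤_; NonZero)
open import Data.Fin using (Fin; _≟_)
open import Data.Fin.Properties using (any?)
open import Data.Product using (Σ; ∃; _×_; _,_)
open import Data.Sum using (_⊎_; inj₁; inj₂)
open import Relation.Nullary using (¬_; yes; no)
open import Relation.Binary.PropositionalEquality using (_≡_)
open import Function.Bundles using (_⇔_)
open import Function.Definitions using (Injective)

record Graph (n : ℕ) : Set₁ where
  field
    Adj    : Fin n → Fin n → Set
    sym    : ∀ {x y} → Adj x y → Adj y x
    irrefl : ∀ {x} → ¬ Adj x x
open Graph public

data Walk {V : Set} (R : V → V → Set) : V → V → ℕ → Set where
  here : ∀ {x} → Walk R x x zero
  step : ∀ {x y z k} → R x y → Walk R y z k → Walk R x z (suc k)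

Dist : {V : Set} → (V → V → Set) → V → V → ℕ → Set
Dist R x y d = Walk R x y d × (∀ k → k < d → ¬ Walk R x y k)

DiamAtMost : {n : ℕ} → Graph n → ℕ → Set
DiamAtMost {n} G D = ∀ (u v : Fin n) → ∃ λ d → d ≤ D × Dist (Adj G) u v d

record CommonInduced (m nJ : ℕ) (nG : Fin m → ℕ) : Set₁ where
  field
    J      : Graph nJ
    G      : (i : Fin m) → Graph (nG i)
    ι      : (i : Fin m) → Fin nJ → Fin (nG i)
    ι-inj  : (i : Fin m) → Injective _≡_ _≡_ (ι i)
    ι-ind  : (i : Fin m) (u v : Fin nJ) → Adj (G i) (ι i u) (ι i v) ⇔ Adj J u v

module Amalgam {m nJ : ℕ} {nG : Fin m → ℕ} (F : CommonInduced m nJ nG) where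
  open CommonInduced F

  -- Vertices of H: vertices of J (the identified vertices) together with,
  -- for each i, the vertices of G i not in the image of ι i.
  VH : Set
  VH = Fin nJ ⊎ Σ (Fin m) (λ i → Σ (Fin (nG i)) (λ x → ¬ ∃ λ v → ι i v ≡ x))

  emb : (i : Fin m) → Fin (nG i) → VH
  emb i x with any? (λ v → ι i v ≟ x)
  ... | yes (v , _) = inj₁ v
  ... | no ¬p       = inj₂ (i , x , ¬p)

  AdjH : VH → VH → Set
  AdjH a b = ∃ λ i → ∃ λ x → ∃ λ y → emb i x ≡ a × emb i y ≡ b × Adj (G i) x y

IsometricInAmalgam : {m nJ : ℕ} {nG : Fin m → ℕ} → CommonInduced m nJ nG → Fin m → Set
IsometricInAmalgam {nG = nG} F i =
  ∀ (x y : Fin (nG i)) (d : ℕ) →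
    Dist (Adj (G i)) x y d ⇔ Dist AdjH (emb i x) (emb i y) d
  where open CommonInduced F
        open Amalgam F

-- A walk in H that leaves G i can only do so through a private vertex of some G j (j ≠ i),
-- entering from a vertex ι j u of the copy of J and returning to G i at some ι j u';
-- such an excursion has length at least 2, while u and u' are at distance at most 2 in J,
-- so it can be replaced by a walk inside the copy ι i of J. Hence every walk in H between
-- vertices of G i can be shortened to a walk in G i, and G i is isometric in H.
module Submission where

open import Defs hiding (sym)
open import Data.Nat using (ℕ; NonZero; suc; _+_; _≤_; _<_; s≤s)
open import Data.Nat.Properties using (≤-refl; ≤-trans; ≤-<-trans; +-monoˡ-≤; m≤n⇒m≤1+n; m≤n⇒m<n∨m≡n)
open import Data.Fin using (Fin; _≟_)
open import Data.Fin.Properties using (any?)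
open import Data.Product using (∃; _×_; _,_)
open import Data.Sum using (inj₁; inj₂)
open import Data.Empty using (⊥-elim)
open import Relation.Nullary using (¬_; yes; no)
open import Relation.Binary.PropositionalEquality using (_≡_; _≢_; refl; sym; trans; cong)
open import Function.Bundles using (_⇔_; mk⇔; Equivalence)

module _ {V : Set} where

  Walk≤ : (V → V → Set) → V → V → ℕ → Set
  Walk≤ R x y k = ∃ λ k′ → k′ ≤ k × Walk R x y k′

  Walk< : (V → V → Set) → V → V → ℕ → Set
  Walk< R x y k = ∃ λ k′ → k′ < k × Walk R x y k′

  _++ʷ_ : ∀ {R : V → V → Set} {x y z k l} → Walk R x y k → Walk R y z l → Walk R x z (k + l)
  here     ++ʷ w′ = w′
  step a w ++ʷ w′ = step a (w ++ʷ w′)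

  step≤ : ∀ {R : V → V → Set} {x y z k} → R x y → Walk≤ R y z k → Walk≤ R x z (suc k)
  step≤ a (k′ , k′≤k , w) = suc k′ , s≤s k′≤k , step a w

module _ {A B : Set} {R : A → A → Set} {S : B → B → Set} (f : A → B)
         (f-hom : ∀ {x y} → R x y → S (f x) (f y)) where

  map-walk : ∀ {x y k} → Walk R x y k → Walk S (f x) (f y) k
  map-walk here       = here
  map-walk (step a w) = step (f-hom a) (map-walk w)

  Dist-preserved : (∀ {x y k} → Walk S (f x) (f y) k → Walk≤ R x y k) →
                   ∀ x y d → Dist R x y d ⇔ Dist S (f x) (f y) d
  Dist-preserved shorten x y d = mk⇔ to from
    where
    to : Dist R x y d → Dist S (f x) (f y) d
    to (w , minimal) = map-walk w , λ k k<d wS →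
      let (k′ , k′≤k , w′) = shorten wS in minimal k′ (≤-<-trans k′≤k k<d) w′

    exact : (∀ k → k < d → ¬ Walk S (f x) (f y) k) → Walk≤ R x y d → Walk R x y d
    exact minimal (k′ , k′≤d , w′) with m≤n⇒m<n∨m≡n k′≤d
    ... | inj₁ k′<d = ⊥-elim (minimal k′ k′<d (map-walk w′))
    ... | inj₂ refl = w′

    from : Dist S (f x) (f y) d → Dist R x y d
    from (wS , minimal) = exact minimal (shorten wS) , λ k k<d w → minimal k k<d (map-walk w)

module _ {m nJ : ℕ} {nG : Fin m → ℕ} (F : CommonInduced m nJ nG) where
  open CommonInduced F
  open Amalgam F

  data EmbView (i : Fin m) (x : Fin (nG i)) : VH → Set where
    shared : (v : Fin nJ) → ι i v ≡ x → EmbView i x (inj₁ v)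
    own    : (p : ¬ ∃ λ v → ι i v ≡ x) → EmbView i x (inj₂ (i , x , p))

  emb-view : (i : Fin m) (x : Fin (nG i)) → EmbView i x (emb i x)
  emb-view i x with any? (λ v → ι i v ≟ x)
  ... | yes (v , e) = shared v e
  ... | no ¬p       = own ¬p

  emb-ι : (i : Fin m) (v : Fin nJ) → emb i (ι i v) ≡ inj₁ v
  emb-ι i v with emb i (ι i v) | emb-view i (ι i v)
  ... | _ | shared _ e = cong inj₁ (ι-inj i e)
  ... | _ | own p      = ⊥-elim (p (v , refl))

  emb-injective : (i : Fin m) {x x′ : Fin (nG i)} → emb i x ≡ emb i x′ → x ≡ x′
  emb-injective i {x} {x′} e with emb i x | emb-view i x | emb i x′ | emb-view i x′
  emb-injective i refl | _ | shared v e | _ | shared .v e′ = trans (sym e) e′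
  emb-injective i refl | _ | own p      | _ | own .p      = refl

  emb-index : (j : Fin m) (x : Fin (nG j)) {j′ : Fin m} {z : Fin (nG j′)} {p : ¬ ∃ λ v → ι j′ v ≡ z} →
              emb j x ≡ inj₂ (j′ , z , p) → j ≡ j′
  emb-index j x e with emb j x | emb-view j x
  emb-index j x refl | _ | own p = refl

  emb-meet : {i j : Fin m} → j ≢ i → (x₀ : Fin (nG j)) (x : Fin (nG i)) → emb j x₀ ≡ emb i x →
             ∃ λ u → x₀ ≡ ι j u × x ≡ ι i u
  emb-meet {i} {j} j≢i x₀ x e with emb j x₀ | emb-view j x₀ | emb i x | emb-view i x
  emb-meet j≢i x₀ x refl | _ | shared v e | _ | shared .v e′ = v , sym e , sym e′
  emb-meet j≢i x₀ x refl | _ | own p      | _ | own .p      = ⊥-elim (j≢i refl)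

  ι-transport : (j i : Fin m) {u v : Fin nJ} → Adj (G j) (ι j u) (ι j v) → Adj (G i) (ι i u) (ι i v)
  ι-transport j i a = Equivalence.from (ι-ind i _ _) (Equivalence.to (ι-ind j _ _) a)

  walk-ι : (i : Fin m) {u v : Fin nJ} {d : ℕ} → Walk (Adj J) u v d → Walk (Adj (G i)) (ι i u) (ι i v) d
  walk-ι i = map-walk (ι i) (Equivalence.from (ι-ind i _ _))

  emb-hom : (i : Fin m) {x y : Fin (nG i)} → Adj (G i) x y → AdjH (emb i x) (emb i y)
  emb-hom i a = i , _ , _ , refl , refl , a

  module Shortening (diam : DiamAtMost J 2) (i : Fin m) (y : Fin (nG i)) where

    -- Established backwards along a walk of length k from a to emb i y in H; the strict
    -- bound at a private vertex of another G j pays for the detour through the copy of J.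
    record Reaches (a : VH) (k : ℕ) : Set where
      field
        from-own     : ∀ {x} → emb i x ≡ a → Walk≤ (Adj (G i)) x y k
        from-foreign : ∀ {j z p} → a ≡ inj₂ (j , z , p) → j ≢ i →
                       ∃ λ u → Walk< (Adj (G i)) (ι i u) y k
    open Reaches

    reaches-target : Reaches (emb i y) 0
    from-own reaches-target e with emb-injective i e
    ... | refl = 0 , ≤-refl , here
    from-foreign reaches-target e j≢i = ⊥-elim (j≢i (sym (emb-index i y e)))

    detour : ∀ {u k} → (∃ λ u′ → Walk< (Adj (G i)) (ι i u′) y k) → Walk≤ (Adj (G i)) (ι i u) y (suc k)
    detour {u} (u′ , k′ , k′<k , w) with diam u u′
    ... | d , d≤2 , (wJ , _) = d + k′ , ≤-trans (+-monoˡ-≤ k′ d≤2) (s≤s k′<k) , walk-ι i wJ ++ʷ w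

    reaches-step : ∀ {a b k} → AdjH a b → Reaches b k → Reaches a (suc k)
    from-own (reaches-step (j , x₀ , y₀ , refl , refl , a) r) {x} e with j ≟ i
    ... | yes refl with emb-injective i e
    ...   | refl = step≤ a (from-own r refl)
    from-own (reaches-step (j , x₀ , y₀ , refl , refl , a) r) {x} e | no j≢i
      with emb-meet j≢i x₀ x (sym e) | emb j y₀ | emb-view j y₀
    ... | u , refl , refl | _ | shared v refl = step≤ (ι-transport j i a) (from-own r (emb-ι i v))
    ... | u , refl , refl | _ | own q         = detour (from-foreign r refl j≢i)
    from-foreign (reaches-step (j , x₀ , y₀ , refl , refl , a) r) e j≢i
      with emb-index j x₀ e | emb j y₀ | emb-view j y₀
    ... | refl | _ | shared v _ =
          let (k′ , k′≤k , w) = from-own r (emb-ι i v) in v , k′ , s≤s k′≤k , w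
    ... | refl | _ | own q =
          let (u , k′ , k′<k , w) = from-foreign r refl j≢i in u , k′ , m≤n⇒m≤1+n k′<k , w

    reaches : ∀ {a k} → Walk AdjH a (emb i y) k → Reaches a k
    reaches here       = reaches-target
    reaches (step a w) = reaches-step a (reaches w)

  shorten : DiamAtMost J 2 → (i : Fin m) {x y : Fin (nG i)} {k : ℕ} →
            Walk AdjH (emb i x) (emb i y) k → Walk≤ (Adj (G i)) x y k
  shorten diam i {y = y} w = Reaches.from-own (reaches w) refl
    where open Shortening diam i y

lemma3 : (m nJ : ℕ) (nG : Fin m → ℕ) (F : CommonInduced m nJ nG) →
    NonZero nJ → ((i : Fin m) → NonZero (nG i)) →
    DiamAtMost (CommonInduced.J F) 2 →
    (i : Fin m) → IsometricInAmalgam F i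
lemma3 m nJ nG F _ _ diam i =
  Dist-preserved (Amalgam.emb F i) (emb-hom F i) (shorten F diam i)
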